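{- If $P$ and $Q$ are $2$-chains, then so is $P\mathbin{\square}Q$.
   Context: All posets are finite; partial orders are written $\preceq$. A poset $(P,\preceq)$ is a $2$-chain if (1) there is a unique way to write $P$ as the union of two chains, and (2) $\preceq$ is maximal subject to (1), i.e. for every proper refinement $\preceq^+$ of $\preceq$ there is more than one way to write $P$ as the union of two $\preceq^+$-chains. A maximal element is supermaximal if it lies above all non-maximal elements; superminimal is defined dually. A $2$-chain with at least $3$ elements has exactly two maximal elements, exactly one supermaximal, and exactly two minimal elements, exactly one superminimal. Splice: if $P$ has exactly two maximal elements $p_0,p_1$ with only $p_0$ supermaximal, and $Q$ has exactly two minimal elements $q_0,q_1$ with only $q_0$ superminimal, then $P\mathbin{\square}Q$ is obtained from the disjoint union $P\sqcup Q$ (orders within $P$ and within $Q$ unchanged; for $a\in P$, $b\in Q$: $a\preceq b$ iff $a\preceq p_i$ in $P$ and $q_i\preceq b$ in $Q$ for some $i\in\{0,1\}$; no element of $Q$ lies below an element of $P$) by identifying $p_0$ with $q_0$ and $p_1$ with $q_1$. For the unique $2$-element $2$-chain $E$ (two incomparable elements), set $P\mathbin{\square}E=P$ and $E\mathbin{\square}Q=Q$. -}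

module Defs where

open import Level using (0ℓ)
open import Data.Nat using (ℕ)
open import Data.Fin using (Fin; _≟_)
open import Data.Bool using (Bool; not)
open import Data.Empty using (⊥)
open import Data.Product using (Σ; _×_; _,_)
open import Data.Sum using (_⊎_)
open import Relation.Nullary using (¬_)
open import Relation.Nullary.Decidable using (False)
open import Relation.Binary.Core using (Rel)
open import Relation.Binary.Definitions using (Decidable)
open import Relation.Binary.Structures using (IsPartialOrder)
open import Relation.Binary.PropositionalEquality using (_≡_; _≢_)

module _ {A : Set} (_≼_ : Rel A 0ℓ) where

  IsMaximal : A → Set
  IsMaximal x = ∀ y → x ≼ y → y ≡ x

  IsMinimal : A → Set
  IsMinimal x = ∀ y → y ≼ x → y ≡ x

  IsSupermaximal : A → Set
  IsSupermaximal x = IsMaximal x × (∀ y → ¬ IsMaximal y → y ≼ x)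

  IsSuperminimal : A → Set
  IsSuperminimal x = IsMinimal x × (∀ y → ¬ IsMinimal y → x ≼ y)

  ExactlyTwoMaximal : A → A → Set
  ExactlyTwoMaximal p₀ p₁ =
    p₀ ≢ p₁ × IsMaximal p₀ × IsMaximal p₁ × (∀ x → IsMaximal x → x ≡ p₀ ⊎ x ≡ p₁)

  ExactlyTwoMinimal : A → A → Set
  ExactlyTwoMinimal q₀ q₁ =
    q₀ ≢ q₁ × IsMinimal q₀ × IsMinimal q₁ × (∀ x → IsMinimal x → x ≡ q₀ ⊎ x ≡ q₁)

  -- A way of writing A as the union of two (possibly empty) chains is
  -- encoded by a colouring f : A → Bool whose two colour classes
  -- f⁻¹(true), f⁻¹(false) are chains.  The colourings f and (not ∘ f)
  -- describe the same (unordered) pair of chains.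
  IsChainColouring : (A → Bool) → Set
  IsChainColouring f = ∀ x y → f x ≡ f y → (x ≼ y) ⊎ (y ≼ x)

  UniqueTwoChainDecomposition : Set
  UniqueTwoChainDecomposition =
    Σ (A → Bool) λ f → IsChainColouring f ×
      (∀ g → IsChainColouring g → (∀ x → g x ≡ f x) ⊎ (∀ x → g x ≡ not (f x)))

  SeveralTwoChainDecompositions : Set
  SeveralTwoChainDecompositions =
    Σ (A → Bool) λ g → Σ (A → Bool) λ h →
      IsChainColouring g × IsChainColouring h ×
      (Σ A λ x → g x ≢ h x) × (Σ A λ y → g y ≢ not (h y))

IsProperRefinement : {A : Set} → Rel A 0ℓ → Rel A 0ℓ → Set
IsProperRefinement {A} _≼_ _≼⁺_ =
  (∀ x y → x ≼ y → x ≼⁺ y) × (Σ A λ x → Σ A λ y → (x ≼⁺ y) × ¬ (x ≼ y))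

record IsTwoChain {A : Set} (_≼_ : Rel A 0ℓ) : Set₁ where
  field
    isPartialOrder : IsPartialOrder _≡_ _≼_
    uniqueDecomposition : UniqueTwoChainDecomposition _≼_
    maximality : ∀ (_≼⁺_ : Rel A 0ℓ) → IsPartialOrder _≡_ _≼⁺_ → Decidable _≼⁺_ →
                 IsProperRefinement _≼_ _≼⁺_ → SeveralTwoChainDecompositions _≼⁺_

-- Splice of P (on Fin n) and Q (on Fin m) along p₀,p₁ ∈ P and q₀,q₁ ∈ Q.
-- The identified elements p₀ = q₀ and p₁ = q₁ are represented by their
-- P-copies, so the carrier is  P ⊎ (Q ∖ {q₀ , q₁}).

SpliceCarrier : (n m : ℕ) (q₀ q₁ : Fin m) → Set
SpliceCarrier n m q₀ q₁ = Fin n ⊎ Σ (Fin m) λ b → False (b ≟ q₀) × False (b ≟ q₁)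

module _ {n m : ℕ} (_≼P_ : Rel (Fin n) 0ℓ) (_≼Q_ : Rel (Fin m) 0ℓ)
         (p₀ p₁ : Fin n) (q₀ q₁ : Fin m) where

  data SpliceOrder : Rel (SpliceCarrier n m q₀ q₁) 0ℓ where
    PP : ∀ {a a'} → a ≼P a' → SpliceOrder (Data.Sum.inj₁ a) (Data.Sum.inj₁ a')
    QQ : ∀ {b b' h h'} → b ≼Q b' →
         SpliceOrder (Data.Sum.inj₂ (b , h)) (Data.Sum.inj₂ (b' , h'))
    PQ₀ : ∀ {a b h} → a ≼P p₀ → q₀ ≼Q b → SpliceOrder (Data.Sum.inj₁ a) (Data.Sum.inj₂ (b , h))
    PQ₁ : ∀ {a b h} → a ≼P p₁ → q₁ ≼Q b → SpliceOrder (Data.Sum.inj₁ a) (Data.Sum.inj₂ (b , h))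

-- Since p₀ is supermaximal and q₀ superminimal, in P □ Q every element of P other than p₁ lies
-- below every element of Q other than q₁.  Hence chain colourings of P and of Q that agree at
-- p₁ = q₁ glue to a chain colouring of P □ Q (p₁ and an element of Q are compared inside Q), and
-- every chain colouring of P □ Q restricts to chain colourings of P and Q that agree at p₀ = q₀;
-- so uniqueness passes from P and Q to P □ Q.  A proper refinement of P □ Q restricts to a proper
-- refinement of P or of Q; the second decomposition it has there, glued to a recolouring of the
-- unique decomposition of the other side, is a second decomposition of P □ Q.
module Submission where

open import Defs
open import Level using (0ℓ)
open import Data.Nat using (ℕ)
open import Data.Fin using (Fin; _≟_)
open import Data.Bool using (Bool; true; false; not; _xor_)
  renaming (_≟_ to _≟ᵇ_)
open import Data.Bool.Properties
  using (not-injective; not-involutive; not-¬; ¬-not; xor-assoc; xor-same; xor-identityʳ; T-irrelevant)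
open import Data.Empty using (⊥-elim)
open import Data.Product using (Σ; _×_; _,_; proj₁; proj₂)
open import Data.Sum using (_⊎_; inj₁; inj₂; swap; [_,_]; [_,_]′) renaming (map to ⊎-map)
open import Data.Sum.Properties using (inj₁-injective)
open import Function.Base using (id; _∘_; _on_; flip)
open import Function.Definitions using (Injective)
open import Relation.Nullary using (¬_; yes; no)
open import Relation.Nullary.Decidable using (False; toWitnessFalse; fromWitnessFalse)
open import Relation.Binary.Core using (Rel; _⇒_)
open import Relation.Binary.Definitions using (Decidable; Reflexive)
open import Relation.Binary.Structures using (IsPartialOrder)
open import Relation.Binary.PropositionalEquality
  using (_≡_; _≢_; refl; sym; trans; cong; cong₂; subst₂; isEquivalence; module ≡-Reasoning)

xor-cancelʳ : ∀ a b → (a xor b) xor b ≡ a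
xor-cancelʳ a b = trans (xor-assoc a b b) (trans (cong (a xor_) (xor-same b)) (xor-identityʳ a))

xor-injective : ∀ c {x y} → c xor x ≡ c xor y → x ≡ y
xor-injective false eq = eq
xor-injective true eq = not-injective eq

≢-≢⇒≡ : ∀ {a b c : Bool} → a ≢ b → b ≢ c → a ≡ c
≢-≢⇒≡ a≢b b≢c = trans (¬-not a≢b) (sym (¬-not (b≢c ∘ sym)))

Comparable : {A : Set} → Rel A 0ℓ → A → A → Set
Comparable _≼_ x y = x ≼ y ⊎ y ≼ x

SameSplit : {A : Set} → (A → Bool) → (A → Bool) → Set
SameSplit g f = (∀ x → g x ≡ f x) ⊎ (∀ x → g x ≡ not (f x))

DistinctColourings : {A : Set} → (A → Bool) → (A → Bool) → Set
DistinctColourings {A} g f = (Σ A λ x → g x ≢ f x) × (Σ A λ y → g y ≢ not (f y))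

module _ {A : Set} where

  isChainColouring-⇒ : ∀ {R R' : Rel A 0ℓ} {f} → R ⇒ R' → IsChainColouring R f → IsChainColouring R' f
  isChainColouring-⇒ R⇒R' f-col x y eq = ⊎-map R⇒R' R⇒R' (f-col x y eq)

  isChainColouring-on : ∀ {B : Set} {R : Rel A 0ℓ} {f} (e : B → A) →
                        IsChainColouring R f → IsChainColouring (R on e) (f ∘ e)
  isChainColouring-on e f-col x y = f-col (e x) (e y)

  isChainColouring-xor : ∀ {R : Rel A 0ℓ} {f} c → IsChainColouring R f → IsChainColouring R ((c xor_) ∘ f)
  isChainColouring-xor c f-col x y eq = f-col x y (xor-injective c eq)

  isChainColouring-incomparable : ∀ {R : Rel A 0ℓ} {f x y} → IsChainColouring R f →
                                  ¬ R x y → ¬ R y x → f x ≢ f y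
  isChainColouring-incomparable {x = x} {y} f-col x⋠y y⋠x eq = [ x⋠y , y⋠x ] (f-col x y eq)

  sameSplit-xor : ∀ {g f : A → Bool} c → SameSplit g f → SameSplit g ((c xor_) ∘ f)
  sameSplit-xor false split = split
  sameSplit-xor true (inj₁ g≗f) = inj₂ λ x → trans (g≗f x) (sym (not-involutive _))
  sameSplit-xor true (inj₂ g≗¬f) = inj₁ g≗¬f

  distinctColourings-either : ∀ {g h f : A → Bool} {x y} → g x ≢ h x → g y ≡ h y →
                              DistinctColourings g f ⊎ DistinctColourings h f
  distinctColourings-either {g} {h} {f} {x} {y} gx≢hx gy≡hy with g x ≟ᵇ f x | g y ≟ᵇ f y
  ... | yes gx≡fx | yes gy≡fy =
    inj₂ ((x , λ hx≡fx → gx≢hx (trans gx≡fx (sym hx≡fx))) , (y , not-¬ (trans (sym gy≡hy) gy≡fy)))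
  ... | yes gx≡fx | no gy≢fy = inj₁ ((y , gy≢fy) , (x , not-¬ gx≡fx))
  ... | no gx≢fx | yes gy≡fy = inj₁ ((x , gx≢fx) , (y , not-¬ gy≡fy))
  ... | no gx≢fx | no gy≢fy =
    inj₂ ((y , λ hy≡fy → gy≢fy (trans gy≡hy hy≡fy)) , (x , not-¬ (≢-≢⇒≡ (gx≢hx ∘ sym) gx≢fx)))

  several⇒distinctColouring : ∀ {R : Rel A 0ℓ} → SeveralTwoChainDecompositions R → ∀ f →
                              Σ (A → Bool) λ k → IsChainColouring R k × DistinctColourings k f
  several⇒distinctColouring (g , h , g-col , h-col , (x , gx≢hx) , (y , gy≢¬hy)) f =
    [ (λ g≉f → g , g-col , g≉f) , (λ h≉f → h , h-col , h≉f) ]′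
      (distinctColourings-either {f = f} gx≢hx (trans (¬-not gy≢¬hy) (not-involutive _)))

  distinctColourings-on : ∀ {B : Set} {k f : A → Bool} {k' f' : B → Bool} (e : B → A) →
                          (∀ b → k (e b) ≡ k' b) → (∀ b → f (e b) ≡ f' b) →
                          DistinctColourings k' f' → DistinctColourings k f
  distinctColourings-on e k∘e f∘e ((s , k's≢f's) , (t , k't≢¬f't)) =
    (e s , λ eq → k's≢f's (trans (sym (k∘e s)) (trans eq (f∘e s)))) ,
    (e t , λ eq → k't≢¬f't (trans (sym (k∘e t)) (trans eq (cong not (f∘e t)))))

  maximal-⋠ : ∀ {R : Rel A 0ℓ} {x y} → IsMaximal R x → x ≢ y → ¬ R x y
  maximal-⋠ x-max x≢y x≼y = x≢y (sym (x-max _ x≼y))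

  minimal-⋡ : ∀ {R : Rel A 0ℓ} {x y} → IsMinimal R y → x ≢ y → ¬ R x y
  minimal-⋡ {R} y-min x≢y = maximal-⋠ {R = flip R} y-min (x≢y ∘ sym)

  below-supermaximal : ∀ {R : Rel A 0ℓ} {p₀ p₁} → Decidable R → Reflexive R →
                       ExactlyTwoMaximal R p₀ p₁ → IsSupermaximal R p₀ → ∀ {a} → a ≢ p₁ → R a p₀
  below-supermaximal {R} {p₀} dec refl-R (_ , _ , _ , maximal⇒p₀∨p₁) (_ , above) {a} a≢p₁
    with dec a p₀
  ... | yes a≼p₀ = a≼p₀
  ... | no a⋠p₀ = ⊥-elim (a⋠p₀ (above a a-not-maximal))
    where
    a-not-maximal : ¬ IsMaximal R a
    a-not-maximal a-max with maximal⇒p₀∨p₁ a a-max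
    ... | inj₁ refl = a⋠p₀ refl-R
    ... | inj₂ a≡p₁ = a≢p₁ a≡p₁

  above-superminimal : ∀ {R : Rel A 0ℓ} {q₀ q₁} → Decidable R → Reflexive R →
                       ExactlyTwoMinimal R q₀ q₁ → IsSuperminimal R q₀ → ∀ {b} → b ≢ q₁ → R q₀ b
  above-superminimal {R} dec = below-supermaximal {R = flip R} (flip dec)

module _ {A B : Set} {_≼_ : Rel A 0ℓ} where

  isPartialOrder-on : (e : B → A) → Injective _≡_ _≡_ e →
                      IsPartialOrder _≡_ _≼_ → IsPartialOrder _≡_ (_≼_ on e)
  isPartialOrder-on e e-injective po = record
    { isPreorder = record
      { isEquivalence = isEquivalence
      ; reflexive = λ { refl → IsPartialOrder.refl po }
      ; trans = IsPartialOrder.trans po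
      }
    ; antisym = λ u≼v v≼u → e-injective (IsPartialOrder.antisym po u≼v v≼u)
    }

  order-reflecting⇒injective : ∀ {_⊑_ : Rel B 0ℓ} (e : B → A) →
                               IsPartialOrder _≡_ _≼_ → IsPartialOrder _≡_ _⊑_ →
                               (_≼_ on e) ⇒ _⊑_ → Injective _≡_ _≡_ e
  order-reflecting⇒injective e po po' reflects eu≡ev =
    IsPartialOrder.antisym po'
      (reflects (IsPartialOrder.reflexive po eu≡ev))
      (reflects (IsPartialOrder.reflexive po (sym eu≡ev)))

  several-on-embedding : ∀ {_⊑_ : Rel B 0ℓ} (e : B → A) → IsTwoChain _⊑_ →
                         IsPartialOrder _≡_ _≼_ → Decidable _≼_ → Injective _≡_ _≡_ e →
                         _⊑_ ⇒ (_≼_ on e) → ∀ {u v} → e u ≼ e v → ¬ u ⊑ v →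
                         SeveralTwoChainDecompositions (_≼_ on e)
  several-on-embedding e two po dec e-injective monotone eu≼ev u⋢v =
    IsTwoChain.maximality two (_≼_ on e) (isPartialOrder-on e e-injective po)
      (λ x y → dec (e x) (e y)) ((λ _ _ → monotone) , (_ , _ , eu≼ev , u⋢v))

module Splice {n m : ℕ} {_≼P_ : Rel (Fin n) 0ℓ} {_≼Q_ : Rel (Fin m) 0ℓ}
              {p₀ p₁ : Fin n} {q₀ q₁ : Fin m}
              (decP : Decidable _≼P_) (decQ : Decidable _≼Q_)
              (twoP : IsTwoChain _≼P_) (twoQ : IsTwoChain _≼Q_)
              (maxP : ExactlyTwoMaximal _≼P_ p₀ p₁) (p₀-supermaximal : IsSupermaximal _≼P_ p₀)
              (minQ : ExactlyTwoMinimal _≼Q_ q₀ q₁) (q₀-superminimal : IsSuperminimal _≼Q_ q₀)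
              where

  open IsPartialOrder (IsTwoChain.isPartialOrder twoP)
    using () renaming (refl to reflP; trans to transP; antisym to antisymP)
  open IsPartialOrder (IsTwoChain.isPartialOrder twoQ)
    using () renaming (refl to reflQ; trans to transQ; antisym to antisymQ)

  p₀≢p₁ : p₀ ≢ p₁
  p₀≢p₁ = proj₁ maxP

  q₀≢q₁ : q₀ ≢ q₁
  q₀≢q₁ = proj₁ minQ

  p₀⋠p₁ : ¬ p₀ ≼P p₁
  p₀⋠p₁ = maximal-⋠ {R = _≼P_} (proj₁ (proj₂ maxP)) p₀≢p₁

  p₁⋠p₀ : ¬ p₁ ≼P p₀
  p₁⋠p₀ = maximal-⋠ {R = _≼P_} (proj₁ (proj₂ (proj₂ maxP))) (p₀≢p₁ ∘ sym)

  ⋠q₀ : ∀ {b} → b ≢ q₀ → ¬ b ≼Q q₀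
  ⋠q₀ = minimal-⋡ {R = _≼Q_} (proj₁ (proj₂ minQ))

  ⋠q₁ : ∀ {b} → b ≢ q₁ → ¬ b ≼Q q₁
  ⋠q₁ = minimal-⋡ {R = _≼Q_} (proj₁ (proj₂ (proj₂ minQ)))

  ≼p₀ : ∀ {a} → a ≢ p₁ → a ≼P p₀
  ≼p₀ = below-supermaximal decP reflP maxP p₀-supermaximal

  q₀≼ : ∀ {b} → b ≢ q₁ → q₀ ≼Q b
  q₀≼ = above-superminimal decQ reflQ minQ q₀-superminimal

  S : Set
  S = SpliceCarrier n m q₀ q₁

  _≼_ : Rel S 0ℓ
  _≼_ = SpliceOrder _≼P_ _≼Q_ p₀ p₁ q₀ q₁

  Inner : Fin m → Set
  Inner b = False (b ≟ q₀) × False (b ≟ q₁)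

  inner≢q₀ : ∀ {b} → Inner b → b ≢ q₀
  inner≢q₀ = toWitnessFalse ∘ proj₁

  inner≢q₁ : ∀ {b} → Inner b → b ≢ q₁
  inner≢q₁ = toWitnessFalse ∘ proj₂

  inj₁≼inj₂ : ∀ {a b h} → a ≢ p₁ → inj₁ a ≼ inj₂ (b , h)
  inj₁≼inj₂ {h = h} a≢p₁ = PQ₀ (≼p₀ a≢p₁) (q₀≼ (inner≢q₁ h))

  ≼-refl : Reflexive _≼_
  ≼-refl {inj₁ a} = PP reflP
  ≼-refl {inj₂ (b , h)} = QQ reflQ

  ≼-trans : ∀ {x y z} → x ≼ y → y ≼ z → x ≼ z
  ≼-trans (PP x≼y) (PP y≼z) = PP (transP x≼y y≼z)
  ≼-trans (PP x≼y) (PQ₀ y≼p₀ q₀≼z) = PQ₀ (transP x≼y y≼p₀) q₀≼z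
  ≼-trans (PP x≼y) (PQ₁ y≼p₁ q₁≼z) = PQ₁ (transP x≼y y≼p₁) q₁≼z
  ≼-trans (QQ x≼y) (QQ y≼z) = QQ (transQ x≼y y≼z)
  ≼-trans (PQ₀ x≼p₀ q₀≼y) (QQ y≼z) = PQ₀ x≼p₀ (transQ q₀≼y y≼z)
  ≼-trans (PQ₁ x≼p₁ q₁≼y) (QQ y≼z) = PQ₁ x≼p₁ (transQ q₁≼y y≼z)

  inj₂-irrelevant : ∀ {b} {h h' : Inner b} → _≡_ {A = S} (inj₂ (b , h)) (inj₂ (b , h'))
  inj₂-irrelevant {h = h₀ , h₁} {h₀' , h₁'} =
    cong (λ h → inj₂ (_ , h)) (cong₂ _,_ (T-irrelevant h₀ h₀') (T-irrelevant h₁ h₁'))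

  ≼-antisym : ∀ {x y} → x ≼ y → y ≼ x → x ≡ y
  ≼-antisym (PP x≼y) (PP y≼x) = cong inj₁ (antisymP x≼y y≼x)
  ≼-antisym (QQ x≼y) (QQ y≼x) with antisymQ x≼y y≼x
  ... | refl = inj₂-irrelevant

  ≼-isPartialOrder : IsPartialOrder _≡_ _≼_
  ≼-isPartialOrder = record
    { isPreorder = record
      { isEquivalence = isEquivalence
      ; reflexive = λ { refl → ≼-refl }
      ; trans = ≼-trans
      }
    ; antisym = ≼-antisym
    }

  data _↪_ (b : Fin m) : S → Set where
    at-q₀ : b ≡ q₀ → b ↪ inj₁ p₀
    at-q₁ : b ≡ q₁ → b ↪ inj₁ p₁
    inner : (h : Inner b) → b ↪ inj₂ (b , h)

  embed : ∀ b → Σ S (b ↪_)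
  embed b with b ≟ q₀ | b ≟ q₁
  ... | yes b≡q₀ | _ = inj₁ p₀ , at-q₀ b≡q₀
  ... | no _ | yes b≡q₁ = inj₁ p₁ , at-q₁ b≡q₁
  ... | no b≢q₀ | no b≢q₁ = inj₂ (b , fromWitnessFalse b≢q₀ , fromWitnessFalse b≢q₁) , inner _

  embedQ : Fin m → S
  embedQ b = proj₁ (embed b)

  ↪embedQ : ∀ b → b ↪ embedQ b
  ↪embedQ b = proj₂ (embed b)

  ↪-mono : ∀ {u v x y} → u ↪ x → v ↪ y → u ≼Q v → x ≼ y
  ↪-mono (at-q₀ _) (at-q₀ _) _ = PP reflP
  ↪-mono (at-q₀ refl) (at-q₁ refl) q₀≼q₁ = ⊥-elim (⋠q₁ q₀≢q₁ q₀≼q₁)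
  ↪-mono (at-q₀ refl) (inner _) q₀≼v = PQ₀ reflP q₀≼v
  ↪-mono (at-q₁ refl) (at-q₀ refl) q₁≼q₀ = ⊥-elim (⋠q₀ (q₀≢q₁ ∘ sym) q₁≼q₀)
  ↪-mono (at-q₁ _) (at-q₁ _) _ = PP reflP
  ↪-mono (at-q₁ refl) (inner _) q₁≼v = PQ₁ reflP q₁≼v
  ↪-mono (inner h) (at-q₀ refl) u≼q₀ = ⊥-elim (⋠q₀ (inner≢q₀ h) u≼q₀)
  ↪-mono (inner h) (at-q₁ refl) u≼q₁ = ⊥-elim (⋠q₁ (inner≢q₁ h) u≼q₁)
  ↪-mono (inner _) (inner _) u≼v = QQ u≼v

  ↪-reflects : ∀ {u v x y} → u ↪ x → v ↪ y → x ≼ y → u ≼Q v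
  ↪-reflects (at-q₀ refl) (at-q₀ refl) _ = reflQ
  ↪-reflects (at-q₀ _) (at-q₁ _) (PP p₀≼p₁) = ⊥-elim (p₀⋠p₁ p₀≼p₁)
  ↪-reflects (at-q₀ refl) (inner h) _ = q₀≼ (inner≢q₁ h)
  ↪-reflects (at-q₁ _) (at-q₀ _) (PP p₁≼p₀) = ⊥-elim (p₁⋠p₀ p₁≼p₀)
  ↪-reflects (at-q₁ refl) (at-q₁ refl) _ = reflQ
  ↪-reflects (at-q₁ _) (inner _) (PQ₀ p₁≼p₀ _) = ⊥-elim (p₁⋠p₀ p₁≼p₀)
  ↪-reflects (at-q₁ refl) (inner _) (PQ₁ _ q₁≼v) = q₁≼v
  ↪-reflects (inner _) (inner _) (QQ u≼v) = u≼v

  ↪-functional : ∀ {b x y} → b ↪ x → b ↪ y → x ≡ y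
  ↪-functional b↪x b↪y = ≼-antisym (↪-mono b↪x b↪y reflQ) (↪-mono b↪y b↪x reflQ)

  embedQ-↪ : ∀ {b x} → b ↪ x → embedQ b ≡ x
  embedQ-↪ = ↪-functional (↪embedQ _)

  embedQ-mono : _≼Q_ ⇒ (_≼_ on embedQ)
  embedQ-mono = ↪-mono (↪embedQ _) (↪embedQ _)

  embedQ-injective : Injective _≡_ _≡_ embedQ
  embedQ-injective = order-reflecting⇒injective embedQ ≼-isPartialOrder
    (IsTwoChain.isPartialOrder twoQ) (↪-reflects (↪embedQ _) (↪embedQ _))

  ↪-comparable : ∀ {R : Rel S 0ℓ} {u v x y} → u ↪ x → v ↪ y →
                 Comparable R (embedQ u) (embedQ v) → Comparable R x y
  ↪-comparable u↪x v↪y = subst₂ (Comparable _) (embedQ-↪ u↪x) (embedQ-↪ v↪y)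

  glue : (Fin n → Bool) → (Fin m → Bool) → S → Bool
  glue kP kQ (inj₁ a) = kP a
  glue kP kQ (inj₂ (b , _)) = kQ b

  glue-↪ : ∀ {kP kQ b x} → kP p₀ ≡ kQ q₀ → kP p₁ ≡ kQ q₁ → b ↪ x → glue kP kQ x ≡ kQ b
  glue-↪ kP≡kQ-at-p₀ _ (at-q₀ refl) = kP≡kQ-at-p₀
  glue-↪ _ kP≡kQ-at-p₁ (at-q₁ refl) = kP≡kQ-at-p₁
  glue-↪ _ _ (inner _) = refl

  glue-isChainColouring : ∀ {_≼⁺_ : Rel S 0ℓ} {kP kQ} → _≼_ ⇒ _≼⁺_ →
                          IsChainColouring (_≼⁺_ on inj₁) kP → IsChainColouring (_≼⁺_ on embedQ) kQ →
                          kP p₁ ≡ kQ q₁ → IsChainColouring _≼⁺_ (glue kP kQ)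
  glue-isChainColouring {_≼⁺_} {kP} {kQ} ≼⇒≼⁺ kP-col kQ-col kP≡kQ-at-p₁ = colouring
    where
    comparable-inj₁-inj₂ : ∀ {a b h} → kP a ≡ kQ b → Comparable _≼⁺_ (inj₁ a) (inj₂ (b , h))
    comparable-inj₁-inj₂ {a} {b} {h} eq with a ≟ p₁
    ... | yes refl =
      ↪-comparable {R = _≼⁺_} (at-q₁ refl) (inner h) (kQ-col q₁ b (trans (sym kP≡kQ-at-p₁) eq))
    ... | no a≢p₁ = inj₁ (≼⇒≼⁺ (inj₁≼inj₂ a≢p₁))

    colouring : IsChainColouring _≼⁺_ (glue kP kQ)
    colouring (inj₁ a) (inj₁ a') = kP-col a a'
    colouring (inj₂ (b , h)) (inj₂ (b' , h')) = ↪-comparable {R = _≼⁺_} (inner h) (inner h') ∘ kQ-col b b'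
    colouring (inj₁ _) (inj₂ _) = comparable-inj₁-inj₂
    colouring (inj₂ _) (inj₁ _) = swap ∘ comparable-inj₁-inj₂ ∘ sym

  overrideAtP₀ : Bool → (Fin n → Bool) → Fin n → Bool
  overrideAtP₀ κ k a with a ≟ p₀
  ... | yes _ = κ
  ... | no _ = k a

  overrideAtP₀-p₀ : ∀ {κ k} → overrideAtP₀ κ k p₀ ≡ κ
  overrideAtP₀-p₀ with p₀ ≟ p₀
  ... | yes _ = refl
  ... | no p₀≢p₀ = ⊥-elim (p₀≢p₀ refl)

  overrideAtP₀-p₁ : ∀ {κ k} → overrideAtP₀ κ k p₁ ≡ k p₁
  overrideAtP₀-p₁ with p₁ ≟ p₀
  ... | yes p₁≡p₀ = ⊥-elim (p₀≢p₁ (sym p₁≡p₀))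
  ... | no _ = refl

  overrideAtP₀-isChainColouring : ∀ {_≼⁺_ : Rel S 0ℓ} {κ k} → _≼_ ⇒ _≼⁺_ → IsChainColouring _≼P_ k →
                                  (κ ≡ k p₁ → Comparable _≼⁺_ (inj₁ p₀) (inj₁ p₁)) →
                                  IsChainColouring (_≼⁺_ on inj₁) (overrideAtP₀ κ k)
  overrideAtP₀-isChainColouring {_≼⁺_} {κ} {k} ≼⇒≼⁺ k-col p₀~p₁ = colouring
    where
    comparable-p₀ : ∀ {a} → κ ≡ k a → Comparable _≼⁺_ (inj₁ p₀) (inj₁ a)
    comparable-p₀ {a} eq with a ≟ p₁
    ... | yes refl = p₀~p₁ eq
    ... | no a≢p₁ = inj₂ (≼⇒≼⁺ (PP (≼p₀ a≢p₁)))

    colouring : IsChainColouring (_≼⁺_ on inj₁) (overrideAtP₀ κ k)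
    colouring x y with x ≟ p₀ | y ≟ p₀
    ... | yes refl | yes refl = λ _ → inj₁ (≼⇒≼⁺ ≼-refl)
    ... | yes refl | no _ = comparable-p₀
    ... | no _ | yes refl = swap ∘ comparable-p₀ ∘ sym
    ... | no _ | no _ = isChainColouring-⇒ (≼⇒≼⁺ ∘ PP) k-col x y

  fP : Fin n → Bool
  fP = proj₁ (IsTwoChain.uniqueDecomposition twoP)

  fP-isChainColouring : IsChainColouring _≼P_ fP
  fP-isChainColouring = proj₁ (proj₂ (IsTwoChain.uniqueDecomposition twoP))

  fP-unique : ∀ g → IsChainColouring _≼P_ g → SameSplit g fP
  fP-unique = proj₂ (proj₂ (IsTwoChain.uniqueDecomposition twoP))

  fQ₀ : Fin m → Bool
  fQ₀ = proj₁ (IsTwoChain.uniqueDecomposition twoQ)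

  shift : Bool
  shift = fP p₀ xor fQ₀ q₀

  fQ : Fin m → Bool
  fQ = (shift xor_) ∘ fQ₀

  fQ-isChainColouring : IsChainColouring _≼Q_ fQ
  fQ-isChainColouring = isChainColouring-xor shift (proj₁ (proj₂ (IsTwoChain.uniqueDecomposition twoQ)))

  fQ-unique : ∀ g → IsChainColouring _≼Q_ g → SameSplit g fQ
  fQ-unique g g-col = sameSplit-xor shift (proj₂ (proj₂ (IsTwoChain.uniqueDecomposition twoQ)) g g-col)

  fP-q₀ : fP p₀ ≡ fQ q₀
  fP-q₀ = sym (xor-cancelʳ (fP p₀) (fQ₀ q₀))

  fP-q₁ : fP p₁ ≡ fQ q₁
  fP-q₁ = ≢-≢⇒≡ fP-p₁≢p₀ (λ eq → fQ-q₀≢q₁ (trans (sym fP-q₀) eq))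
    where
    fP-p₁≢p₀ : fP p₁ ≢ fP p₀
    fP-p₁≢p₀ = isChainColouring-incomparable fP-isChainColouring p₁⋠p₀ p₀⋠p₁
    fQ-q₀≢q₁ : fQ q₀ ≢ fQ q₁
    fQ-q₀≢q₁ = isChainColouring-incomparable fQ-isChainColouring (⋠q₁ q₀≢q₁) (⋠q₀ (q₀≢q₁ ∘ sym))

  f : S → Bool
  f = glue fP fQ

  f-isChainColouring : IsChainColouring _≼_ f
  f-isChainColouring = glue-isChainColouring id
    (isChainColouring-⇒ PP fP-isChainColouring)
    (isChainColouring-⇒ embedQ-mono fQ-isChainColouring) fP-q₁

  f-unique : ∀ g → IsChainColouring _≼_ g → SameSplit g f
  f-unique g g-col = combine (fP-unique (g ∘ inj₁) gP-col) (fQ-unique (g ∘ embedQ) gQ-col)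
    where
    open ≡-Reasoning

    gP-col : IsChainColouring _≼P_ (g ∘ inj₁)
    gP-col = isChainColouring-⇒ (λ { (PP a≼a') → a≼a' }) (isChainColouring-on inj₁ g-col)

    gQ-col : IsChainColouring _≼Q_ (g ∘ embedQ)
    gQ-col = isChainColouring-⇒ (↪-reflects (↪embedQ _) (↪embedQ _)) (isChainColouring-on embedQ g-col)

    g-p₀≡g-q₀ : g (inj₁ p₀) ≡ g (embedQ q₀)
    g-p₀≡g-q₀ = cong g (sym (embedQ-↪ (at-q₀ refl)))

    g-inner : ∀ {b} (h : Inner b) → g (inj₂ (b , h)) ≡ g (embedQ b)
    g-inner h = cong g (sym (embedQ-↪ (inner h)))

    combine : SameSplit (g ∘ inj₁) fP → SameSplit (g ∘ embedQ) fQ → SameSplit g f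
    combine (inj₁ gP≗fP) (inj₁ gQ≗fQ) =
      inj₁ λ { (inj₁ a) → gP≗fP a ; (inj₂ (b , h)) → trans (g-inner h) (gQ≗fQ b) }
    combine (inj₂ gP≗¬fP) (inj₂ gQ≗¬fQ) =
      inj₂ λ { (inj₁ a) → gP≗¬fP a ; (inj₂ (b , h)) → trans (g-inner h) (gQ≗¬fQ b) }
    combine (inj₁ gP≗fP) (inj₂ gQ≗¬fQ) = ⊥-elim (not-¬ refl (begin
      fP p₀             ≡⟨ sym (gP≗fP p₀) ⟩
      g (inj₁ p₀)       ≡⟨ g-p₀≡g-q₀ ⟩
      g (embedQ q₀)     ≡⟨ gQ≗¬fQ q₀ ⟩
      not (fQ q₀)       ≡⟨ cong not (sym fP-q₀) ⟩
      not (fP p₀)       ∎))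
    combine (inj₂ gP≗¬fP) (inj₁ gQ≗fQ) = ⊥-elim (not-¬ refl (begin
      fP p₀             ≡⟨ fP-q₀ ⟩
      fQ q₀             ≡⟨ sym (gQ≗fQ q₀) ⟩
      g (embedQ q₀)     ≡⟨ sym g-p₀≡g-q₀ ⟩
      g (inj₁ p₀)       ≡⟨ gP≗¬fP p₀ ⟩
      not (fP p₀)       ∎))

  module Refinement {_≼⁺_ : Rel S 0ℓ} (po⁺ : IsPartialOrder _≡_ _≼⁺_) (dec⁺ : Decidable _≼⁺_)
                    (≼⇒≼⁺ : _≼_ ⇒ _≼⁺_) where

    several-fromP : ∀ {a a'} → inj₁ a ≼⁺ inj₁ a' → ¬ a ≼P a' → SeveralTwoChainDecompositions _≼⁺_
    several-fromP a≼⁺a' a⋠a'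
      with several⇒distinctColouring
             (several-on-embedding inj₁ twoP po⁺ dec⁺ inj₁-injective (≼⇒≼⁺ ∘ PP) a≼⁺a' a⋠a') fP
    ... | kP , kP-col , kP≉fP =
      glue kP kQ , f ,
      glue-isChainColouring ≼⇒≼⁺ kP-col kQ-col (sym (xor-cancelʳ (kP p₁) (fQ q₁))) ,
      isChainColouring-⇒ ≼⇒≼⁺ f-isChainColouring ,
      distinctColourings-on inj₁ (λ _ → refl) (λ _ → refl) kP≉fP
      where
      c : Bool
      c = kP p₁ xor fQ q₁
      kQ : Fin m → Bool
      kQ = (c xor_) ∘ fQ
      kQ-col : IsChainColouring (_≼⁺_ on embedQ) kQ
      kQ-col = isChainColouring-⇒ (≼⇒≼⁺ ∘ embedQ-mono) (isChainColouring-xor c fQ-isChainColouring)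

    several-fromQ : ∀ {u v x y} → u ↪ x → v ↪ y → x ≼⁺ y → ¬ x ≼ y → SeveralTwoChainDecompositions _≼⁺_
    several-fromQ {u} {v} u↪x v↪y x≼⁺y x⋠y
      with several⇒distinctColouring
             (several-on-embedding embedQ twoQ po⁺ dec⁺ embedQ-injective (≼⇒≼⁺ ∘ embedQ-mono) {u} {v}
                (subst₂ _≼⁺_ (sym (embedQ-↪ u↪x)) (sym (embedQ-↪ v↪y)) x≼⁺y)
                (x⋠y ∘ subst₂ _≼_ (embedQ-↪ u↪x) (embedQ-↪ v↪y) ∘ embedQ-mono)) fQ
    ... | kQ , kQ-col , kQ≉fQ =
      glue kP kQ , f ,
      glue-isChainColouring ≼⇒≼⁺ kP-col kQ-col kP-p₁ ,
      isChainColouring-⇒ ≼⇒≼⁺ f-isChainColouring ,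
      distinctColourings-on embedQ (λ b → glue-↪ overrideAtP₀-p₀ kP-p₁ (↪embedQ b))
                                   (λ b → glue-↪ fP-q₀ fP-q₁ (↪embedQ b)) kQ≉fQ
      where
      c : Bool
      c = kQ q₁ xor fP p₁
      -- kQ may give q₀ and q₁ the same colour, which no recolouring of fP does to p₀ and p₁.
      kP : Fin n → Bool
      kP = overrideAtP₀ (kQ q₀) ((c xor_) ∘ fP)
      kP-p₁ : kP p₁ ≡ kQ q₁
      kP-p₁ = trans overrideAtP₀-p₁ (xor-cancelʳ (kQ q₁) (fP p₁))
      kP-col : IsChainColouring (_≼⁺_ on inj₁) kP
      kP-col = overrideAtP₀-isChainColouring ≼⇒≼⁺ (isChainColouring-xor c fP-isChainColouring)
        (λ kQ-q₀≡kQ-q₁ → ↪-comparable {R = _≼⁺_} (at-q₀ refl) (at-q₁ refl)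
           (kQ-col q₀ q₁ (trans kQ-q₀≡kQ-q₁ (xor-cancelʳ (kQ q₁) (fP p₁)))))

    several-from-new-comparability : ∀ {x y} → x ≼⁺ y → ¬ x ≼ y → SeveralTwoChainDecompositions _≼⁺_
    several-from-new-comparability {inj₁ a} {inj₁ a'} x≼⁺y x⋠y = several-fromP x≼⁺y (x⋠y ∘ PP)
    several-from-new-comparability {inj₂ (b , h)} {inj₂ (b' , h')} = several-fromQ (inner h) (inner h')
    several-from-new-comparability {inj₁ a} {inj₂ (b , h)} x≼⁺y x⋠y with a ≟ p₁
    ... | yes refl = several-fromQ (at-q₁ refl) (inner h) x≼⁺y x⋠y
    ... | no a≢p₁ = ⊥-elim (x⋠y (inj₁≼inj₂ a≢p₁))
    several-from-new-comparability {inj₂ (b , h)} {inj₁ a} x≼⁺y x⋠y with a ≟ p₁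
    ... | yes refl = several-fromQ (inner h) (at-q₁ refl) x≼⁺y x⋠y
    ... | no a≢p₁ with IsPartialOrder.antisym po⁺ x≼⁺y (≼⇒≼⁺ (inj₁≼inj₂ a≢p₁))
    ...   | ()

proposition5p1 : ∀ (n m : ℕ) (_≼P_ : Rel (Fin n) 0ℓ) (_≼Q_ : Rel (Fin m) 0ℓ)
    (p₀ p₁ : Fin n) (q₀ q₁ : Fin m) →
    Decidable _≼P_ → Decidable _≼Q_ →
    IsTwoChain _≼P_ → IsTwoChain _≼Q_ →
    ExactlyTwoMaximal _≼P_ p₀ p₁ → IsSupermaximal _≼P_ p₀ → ¬ IsSupermaximal _≼P_ p₁ →
    ExactlyTwoMinimal _≼Q_ q₀ q₁ → IsSuperminimal _≼Q_ q₀ → ¬ IsSuperminimal _≼Q_ q₁ →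
    IsTwoChain (SpliceOrder _≼P_ _≼Q_ p₀ p₁ q₀ q₁)
proposition5p1 _ _ _ _ _ _ _ _ decP decQ twoP twoQ maxP p₀-supermaximal _ minQ q₀-superminimal _ =
  record
    { isPartialOrder = ≼-isPartialOrder
    ; uniqueDecomposition = f , f-isChainColouring , f-unique
    ; maximality = λ _ po⁺ dec⁺ (≼⊆≼⁺ , _ , _ , x≼⁺y , x⋠y) →
        Refinement.several-from-new-comparability po⁺ dec⁺ (≼⊆≼⁺ _ _) x≼⁺y x⋠y
    }
  where open Splice decP decQ twoP twoQ maxP p₀-supermaximal minQ q₀-superminimal
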